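{- If a sequent $\Gamma\Rightarrow\Delta$ is derivable in $\mathbf{G}(\mathsf{FBInqBQ})$, then $\mathfrak M,f\Vdash_g\Gamma\Rightarrow\Delta$ holds for every relational information model $\mathfrak M=(W,D,\mathfrak I)$, every assignment $g:\mathsf{Var}\to D$ and every mapping $f:\omega\to W$.
   Context: Language: countably infinite set $\mathsf{Var}$ of variables, countably infinite set $\mathsf{Pred}$ of predicate symbols with arities (no identity, constants, function symbols). Formulas: $\varphi ::= P(x_1,\dots,x_m)\mid \bot\mid \varphi\to\varphi\mid\varphi\wedge\varphi\mid \varphi\veebar\varphi\mid \forall x\varphi\mid \bar\exists x\varphi$ ($\veebar$ inquisitive disjunction, $\bar\exists$ inquisitive existential). $\varphi[z/x]$ is capture-avoiding substitution. Semantics: a relational information model $\mathfrak M=(W,D,\mathfrak I)$ has nonempty $W$, nonempty $D$, $\mathfrak I(P,w)\subseteq D^m$; for states $s\subseteq W$ and $g:\mathsf{Var}\to D$: $s\Vdash_g P(\bar x)$ iff $g(\bar x)\in\mathfrak I(P,w)$ for all $w\in s$; $s\Vdash_g\bot$ iff $s=\varnothing$; $\wedge$ pointwise; $s\Vdash_g\varphi\to\psi$ iff every $t\subseteq s$ supporting $\varphi$ supports $\psi$; $s\Vdash_g\varphi\veebar\psi$ iff $s\Vdash_g\varphi$ or $s\Vdash_g\psi$; $\forall x$ / $\bar\exists x$: for all / some $d\in D$, $s\Vdash_{g[x\mapsto d]}\varphi$. For $f:\omega\to W$: $\mathfrak M,f\Vdash_g X:\varphi$ iff $\mathfrak M,f[X]\Vdash_g\varphi$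 (with $f[X]$ the image of $X$); $\mathfrak M,f\Vdash_g\Gamma\Rightarrow\Delta$ means: if $\mathfrak M,f\Vdash_g X:\varphi$ for all $X:\varphi\in\Gamma$, then $\mathfrak M,f\Vdash_g Y:\psi$ for some $Y:\psi\in\Delta$. Calculus $\mathbf{G}(\mathsf{FBInqBQ})$: a label is a nonempty finite subset of $\omega$; a labelled formula is $X:\varphi$ with $X$ a label; a sequent $\Gamma\Rightarrow\Delta$ is a pair of finite multisets of labelled formulas. $X,Y$ range over labels. Initial sequents: $(\mathtt{id})$ $X:P(\bar x),\Gamma\Rightarrow\Delta,Y:P(\bar x)$ whenever $X\supseteq Y$; $(\bot\Rightarrow)$ $X:\bot,\Gamma\Rightarrow\Delta$. Rules (premises / conclusion): $(\Rightarrow\mathtt{at})$: $\Gamma\Rightarrow\Delta,\{k\}:P(\bar x)$ for every $k\in X$ / $\Gamma\Rightarrow\Delta,X:P(\bar x)$. $(\Rightarrow\wedge)$: $\Gamma\Rightarrow\Delta,X:\varphi$ and $\Gamma\Rightarrow\Delta,X:\psi$ / $\Gamma\Rightarrow\Delta,X:\varphi\wedge\psi$. $(\wedge\Rightarrow)$: $X:\varphi,X:\psi,\Gamma\Rightarrow\Delta$ / $X:\varphi\wedge\psi,\Gamma\Rightarrow\Delta$. $(\Rightarrow\veebar)$: $\Gamma\Rightarrow\Delta,X:\varphi,X:\psi$ / $\Gamma\Rightarrow\Delta,X:\varphi\veebar\psi$. $(\veebar\Rightarrow)$: $X:\varphi,\Gamma\Rightarrow\Delta$ and $X:\psi,\Gamma\Rightarrow\Delta$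 / $X:\varphi\veebar\psi,\Gamma\Rightarrow\Delta$. $(\Rightarrow\to)$: $Y:\varphi,\Gamma\Rightarrow\Delta,Y:\psi$ for every label $Y\subseteq X$ / $\Gamma\Rightarrow\Delta,X:\varphi\to\psi$. $(\to\Rightarrow)$, for a label $Y\subseteq X$: $X:\varphi\to\psi,\Gamma\Rightarrow\Delta,Y:\varphi$ and $Y:\psi,X:\varphi\to\psi,\Gamma\Rightarrow\Delta$ / $X:\varphi\to\psi,\Gamma\Rightarrow\Delta$. $(\Rightarrow\forall)$: $\Gamma\Rightarrow\Delta,X:\varphi[z/x]$ / $\Gamma\Rightarrow\Delta,X:\forall x\varphi$, with $z$ not occurring in the conclusion. $(\forall\Rightarrow)$: $X:\varphi[y/x],X:\forall x\varphi,\Gamma\Rightarrow\Delta$ / $X:\forall x\varphi,\Gamma\Rightarrow\Delta$ ($y$ arbitrary). $(\Rightarrow\bar\exists)$: $\Gamma\Rightarrow\Delta,X:\bar\exists x\varphi,X:\varphi[y/x]$ / $\Gamma\Rightarrow\Delta,X:\bar\exists x\varphi$ ($y$ arbitrary). $(\bar\exists\Rightarrow)$: $X:\varphi[z/x],\Gamma\Rightarrow\Delta$ / $X:\bar\exists x\varphi,\Gamma\Rightarrow\Delta$, with $z$ not occurring in the conclusion. A derivation is a finite tree of sequents built from initial sequents by these rules; a sequent is derivable if it is the root of a derivation. -}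

module Defs where

open import Level using (Level; Lift; 0ℓ) renaming (suc to lsuc)
open import Data.Nat using (ℕ; suc; _<_; _≟_; _⊔_)
open import Data.Bool using (Bool; true; false; if_then_else_)
open import Data.Empty using (⊥)
open import Data.Product using (Σ; _×_; _,_)
open import Data.Sum using (_⊎_)
open import Data.List using (List; []; _∷_; map; filter; foldr; concatMap; _++_)
open import Data.Vec using (Vec) renaming (map to vmap)
import Data.Vec as V
open import Data.List.Membership.Propositional using (_∈_; _∉_)
open import Data.List.Membership.DecPropositional _≟_ using (_∈?_)
open import Data.List.Relation.Unary.All using (All)
open import Data.List.Relation.Unary.AllPairs using (AllPairs)
open import Data.List.Relation.Unary.Any using (Any)
open import Data.List.Relation.Binary.Permutation.Propositional using (_↭_)
open import Relation.Binary.PropositionalEquality using (_≡_; _≢_)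
open import Relation.Nullary using (¬_; does)
open import Relation.Nullary.Decidable using (¬?)

Var : Set
Var = ℕ

record PSym : Set where
  constructor psym
  field
    name  : ℕ
    arity : ℕ
open PSym public

infixr 25 _⊃_
infixr 30 _⩒_
infixr 35 _∧_

data Fm : Set where
  atom : (P : PSym) → Vec Var (arity P) → Fm
  ⊥'   : Fm
  _⊃_  : Fm → Fm → Fm
  _∧_  : Fm → Fm → Fm
  _⩒_  : Fm → Fm → Fm
  ∀'   : Var → Fm → Fm
  ∃̄    : Var → Fm → Fm

fv : Fm → List Var
fv (atom P xs) = V.toList xs
fv ⊥' = []
fv (φ ⊃ ψ) = fv φ ++ fv ψ
fv (φ ∧ ψ) = fv φ ++ fv ψ
fv (φ ⩒ ψ) = fv φ ++ fv ψ
fv (∀' u φ) = filter (λ v → ¬? (v ≟ u)) (fv φ)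
fv (∃̄ u φ) = filter (λ v → ¬? (v ≟ u)) (fv φ)

occ : Fm → List Var
occ (atom P xs) = V.toList xs
occ ⊥' = []
occ (φ ⊃ ψ) = occ φ ++ occ ψ
occ (φ ∧ ψ) = occ φ ++ occ ψ
occ (φ ⩒ ψ) = occ φ ++ occ ψ
occ (∀' u φ) = u ∷ occ φ
occ (∃̄ u φ) = u ∷ occ φ

_[_↦_] : {A : Set} → (Var → A) → Var → A → (Var → A)
(σ [ x ↦ a ]) v = if does (v ≟ x) then a else σ v

maxL : List ℕ → ℕ
maxL = foldr _⊔_ 0

private
  binder : (Var → Var) → Var → Fm → Var
  binder σ u φ =
    let avoid = map σ (filter (λ v → ¬? (v ≟ u)) (fv φ)) in
    if does (u ∈? avoid) then suc (maxL avoid) else u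

sub : (Var → Var) → Fm → Fm
sub σ (atom P xs) = atom P (vmap σ xs)
sub σ ⊥' = ⊥'
sub σ (φ ⊃ ψ) = sub σ φ ⊃ sub σ ψ
sub σ (φ ∧ ψ) = sub σ φ ∧ sub σ ψ
sub σ (φ ⩒ ψ) = sub σ φ ⩒ sub σ ψ
sub σ (∀' u φ) = let w = binder σ u φ in ∀' w (sub (σ [ u ↦ w ]) φ)
sub σ (∃̄ u φ) = let w = binder σ u φ in ∃̄ w (sub (σ [ u ↦ w ]) φ)

-- φ [ z / x ] : capture-avoiding substitution of z for x
_[_/_] : Fm → Var → Var → Fm
φ [ z / x ] = sub ((λ v → v) [ x ↦ z ]) φ

-- Labels: nonempty finite subsets of ω, in canonical form
-- (strictly increasing nonempty lists).

record Label : Set where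
  constructor label
  field
    elems    : List ℕ
    sorted   : AllPairs _<_ elems
    nonempty : elems ≢ []
open Label public

_∈L_ : ℕ → Label → Set
k ∈L X = k ∈ elems X

_⊆L_ : Label → Label → Set
Y ⊆L X = ∀ {k} → k ∈L Y → k ∈L X

｛_｝ : ℕ → Label
｛ k ｝ = label (k ∷ []) (All.[] AllPairs.∷ AllPairs.[]) (λ ())
  where
  import Data.List.Relation.Unary.All as All
  import Data.List.Relation.Unary.AllPairs as AllPairs

infix 10 _∶_
infix 40 _[_/_]
record LFm : Set where
  constructor _∶_
  field
    lab : Label
    fm  : Fm
open LFm public

occs : List LFm → List Var
occs = concatMap (λ A → occ (fm A))

-- The calculus G(FBInqBQ).  A sequent Γ ⇒ Δ is a pair of lists;
-- multiset reading is obtained via the structural rule `perm`.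
-- `G Γ Δ` : the sequent Γ ⇒ Δ is derivable.

data G : List LFm → List LFm → Set where
  id   : ∀ {X Y P xs Γ Δ} → Y ⊆L X →
         G ((X ∶ atom P xs) ∷ Γ) ((Y ∶ atom P xs) ∷ Δ)
  ⊥⇒   : ∀ {X Γ Δ} → G ((X ∶ ⊥') ∷ Γ) Δ
  ⇒at  : ∀ {X P xs Γ Δ} →
         (∀ k → k ∈L X → G Γ ((｛ k ｝ ∶ atom P xs) ∷ Δ)) →
         G Γ ((X ∶ atom P xs) ∷ Δ)
  ⇒∧   : ∀ {X φ ψ Γ Δ} → G Γ ((X ∶ φ) ∷ Δ) → G Γ ((X ∶ ψ) ∷ Δ) →
         G Γ ((X ∶ φ ∧ ψ) ∷ Δ)
  ∧⇒   : ∀ {X φ ψ Γ Δ} → G ((X ∶ φ) ∷ (X ∶ ψ) ∷ Γ) Δ →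
         G ((X ∶ φ ∧ ψ) ∷ Γ) Δ
  ⇒⩒   : ∀ {X φ ψ Γ Δ} → G Γ ((X ∶ φ) ∷ (X ∶ ψ) ∷ Δ) →
         G Γ ((X ∶ φ ⩒ ψ) ∷ Δ)
  ⩒⇒   : ∀ {X φ ψ Γ Δ} → G ((X ∶ φ) ∷ Γ) Δ → G ((X ∶ ψ) ∷ Γ) Δ →
         G ((X ∶ φ ⩒ ψ) ∷ Γ) Δ
  ⇒⊃   : ∀ {X φ ψ Γ Δ} →
         (∀ Y → Y ⊆L X → G ((Y ∶ φ) ∷ Γ) ((Y ∶ ψ) ∷ Δ)) →
         G Γ ((X ∶ φ ⊃ ψ) ∷ Δ)
  ⊃⇒   : ∀ {X φ ψ Γ Δ} (Y : Label) → Y ⊆L X →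
         G ((X ∶ φ ⊃ ψ) ∷ Γ) ((Y ∶ φ) ∷ Δ) →
         G ((Y ∶ ψ) ∷ (X ∶ φ ⊃ ψ) ∷ Γ) Δ →
         G ((X ∶ φ ⊃ ψ) ∷ Γ) Δ
  ⇒∀   : ∀ {X x φ Γ Δ} (z : Var) →
         z ∉ occs (Γ ++ (X ∶ ∀' x φ) ∷ Δ) →
         G Γ ((X ∶ φ [ z / x ]) ∷ Δ) →
         G Γ ((X ∶ ∀' x φ) ∷ Δ)
  ∀⇒   : ∀ {X x φ Γ Δ} (y : Var) →
         G ((X ∶ φ [ y / x ]) ∷ (X ∶ ∀' x φ) ∷ Γ) Δ →
         G ((X ∶ ∀' x φ) ∷ Γ) Δ
  ⇒∃̄   : ∀ {X x φ Γ Δ} (y : Var) →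
         G Γ ((X ∶ ∃̄ x φ) ∷ (X ∶ φ [ y / x ]) ∷ Δ) →
         G Γ ((X ∶ ∃̄ x φ) ∷ Δ)
  ∃̄⇒   : ∀ {X x φ Γ Δ} (z : Var) →
         z ∉ occs ((X ∶ ∃̄ x φ) ∷ Γ ++ Δ) →
         G ((X ∶ φ [ z / x ]) ∷ Γ) Δ →
         G ((X ∶ ∃̄ x φ) ∷ Γ) Δ
  perm : ∀ {Γ Γ' Δ Δ'} → Γ ↭ Γ' → Δ ↭ Δ' → G Γ Δ → G Γ' Δ'

record Model : Set₁ where
  field
    W    : Set
    D    : Set
    w₀   : W          -- W nonempty
    d₀   : D          -- D nonempty
    𝔍    : (P : PSym) → W → Vec D (arity P) → Set
open Model public

State : Model → Set₁
State M = W M → Set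

Supp : (M : Model) → State M → (Var → D M) → Fm → Set₁
Supp M s g (atom P xs) = ∀ w → s w → Lift (lsuc 0ℓ) (𝔍 M P w (vmap g xs))
Supp M s g ⊥' = ∀ w → s w → Lift (lsuc 0ℓ) ⊥        -- s = ∅
Supp M s g (φ ⊃ ψ) = (t : State M) → (∀ w → t w → s w) →
                     Supp M t g φ → Supp M t g ψ
Supp M s g (φ ∧ ψ) = Supp M s g φ × Supp M s g ψ
Supp M s g (φ ⩒ ψ) = Supp M s g φ ⊎ Supp M s g ψ
Supp M s g (∀' x φ) = (d : D M) → Supp M s (g [ x ↦ d ]) φ
Supp M s g (∃̄ x φ) = Σ (D M) (λ d → Supp M s (g [ x ↦ d ]) φ)

img : (M : Model) → (ℕ → W M) → Label → State M
img M f X w = Σ ℕ (λ k → k ∈L X × f k ≡ w)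

SatLF : (M : Model) → (ℕ → W M) → (Var → D M) → LFm → Set₁
SatLF M f g (X ∶ φ) = Supp M (img M f X) g φ

SatSeq : (M : Model) → (ℕ → W M) → (Var → D M) → List LFm → List LFm → Set₁
SatSeq M f g Γ Δ = All (SatLF M f g) Γ → Any (SatLF M f g) Δ

{-# OPTIONS --safe #-}

-- Support is persistent under substates, holds trivially at the
-- empty state, and depends only on the free variables, with substitution commuting with
-- updating the assignment; this makes the left rules and the quantifier rules sound, the
-- eigenvariable conditions allowing the eigenvariable to be reassigned freely.
-- The right rules for atoms, implication and ∀ have premises indexed by points, sublabels
-- and objects, so one argues classically: unless Δ holds, every premise yields its
-- principal formula. For implication that suffices because every nonempty substate t of
-- f[X] is f[Y] for the sublabel Y = {k ∈ X ∣ f k ∈ t}.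

module Submission where

open import Defs
open import Level using (0ℓ; Lift; lift; lower) renaming (suc to lsuc)
open import Function using (_∘_)
open import Function.Bundles using (_⇔_; mk⇔; module Equivalence)
import Function.Properties.Equivalence as ⇔
open import Data.Nat using (ℕ; suc; _≤_; _<_; _≟_)
open import Data.Nat.Properties using (m≤m⊔n; m≤n⊔m; ≤-trans; n≮n)
open import Data.Bool using (if_then_else_)
open import Data.Bool.Properties using (if-float)
open import Data.Empty using (⊥-elim)
open import Data.Product using (Σ; _×_; _,_; proj₁; proj₂; map₂)
import Data.Product
open import Data.Product.Function.NonDependent.Propositional using (_×-⇔_)
open import Data.Sum using (_⊎_; inj₁; inj₂)
import Data.Sum as Sum
open import Data.Sum.Function.Propositional using (_⊎-⇔_)
open import Data.List using (List; []; _∷_; _++_; map; filter)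
open import Data.Vec using (Vec; []; _∷_) renaming (map to vmap; toList to vtoList)
open import Data.Vec.Properties using (map-∘)
open import Data.List.Membership.Propositional using (_∈_; _∉_)
open import Data.List.Relation.Binary.Subset.Propositional using (_⊆_)
open import Data.List.Relation.Binary.Subset.Propositional.Properties using (++⁺; filter-⊆)
open import Data.List.Membership.Propositional.Properties
  using (∈-filter⁺; ∈-filter⁻; ∈-map⁺; ∈-++⁺ˡ; ∈-++⁺ʳ; ∈-concatMap⁺)
open import Data.List.Membership.DecPropositional _≟_ using (_∈?_)
open import Data.List.Relation.Unary.All as All using (All; []; _∷_)
open import Data.List.Relation.Unary.All.Properties using (++⁻; ¬Any⇒All¬)
open import Data.List.Relation.Unary.Any as Any using (Any; here; there)
open import Data.List.Relation.Unary.AllPairs using (AllPairs)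
import Data.List.Relation.Unary.AllPairs.Properties as AllPairs
open import Data.List.Relation.Binary.Permutation.Propositional using (↭-sym)
open import Data.List.Relation.Binary.Permutation.Propositional.Properties
  using (All-resp-↭; Any-resp-↭)
open import Relation.Binary.PropositionalEquality
  using (_≡_; _≢_; refl; sym; trans; cong; cong₂; subst; module ≡-Reasoning)
open import Relation.Nullary using (¬_; yes; no; does; contradiction)
open import Relation.Nullary.Decidable using (¬?; dec-true; dec-false)
open import Relation.Unary using (Decidable)
open import Axiom.ExcludedMiddle using (ExcludedMiddle)

open Equivalence using (to; from)

update-≡ : {A : Set} (g : Var → A) (x : Var) (d : A) → (g [ x ↦ d ]) x ≡ d
update-≡ g x d rewrite dec-true (x ≟ x) refl = refl

update-≢ : {A : Set} (g : Var → A) {x v : Var} (d : A) → v ≢ x → (g [ x ↦ d ]) v ≡ g v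
update-≢ g {x} {v} d v≢x rewrite dec-false (v ≟ x) v≢x = refl

maxL-≤ : ∀ {a} (L : List ℕ) → a ∈ L → a ≤ maxL L
maxL-≤ (b ∷ L) (here refl) = m≤m⊔n b (maxL L)
maxL-≤ (b ∷ L) (there a∈) = ≤-trans (maxL-≤ L a∈) (m≤n⊔m b (maxL L))

-- The bound variable `sub σ` chooses under `∀' u φ` and `∃̄ u φ`; the definitions keep it private.
boundVar : (Var → Var) → Var → Fm → Var
boundVar σ u φ =
  let avoid = map σ (fv (∀' u φ)) in if does (u ∈? avoid) then suc (maxL avoid) else u

boundVar-∉ : ∀ σ u φ → boundVar σ u φ ∉ map σ (fv (∀' u φ))
boundVar-∉ σ u φ with u ∈? map σ (fv (∀' u φ))
... | yes _  = λ m∈ → n≮n _ (maxL-≤ _ m∈)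
... | no u∉ = u∉

fv⊆occ : ∀ φ → fv φ ⊆ occ φ
fv⊆occ (atom P xs) = λ v∈ → v∈
fv⊆occ ⊥'         = λ ()
fv⊆occ (φ ⊃ ψ)    = ++⁺ (fv⊆occ φ) (fv⊆occ ψ)
fv⊆occ (φ ∧ ψ)    = ++⁺ (fv⊆occ φ) (fv⊆occ ψ)
fv⊆occ (φ ⩒ ψ)    = ++⁺ (fv⊆occ φ) (fv⊆occ ψ)
fv⊆occ (∀' u φ)   = there ∘ fv⊆occ φ ∘ filter-⊆ (λ v → ¬? (v ≟ u)) (fv φ)
fv⊆occ (∃̄ u φ)    = there ∘ fv⊆occ φ ∘ filter-⊆ (λ v → ¬? (v ≟ u)) (fv φ)

Fresh : Var → LFm → Set
Fresh z A = z ∉ fv (fm A)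

∉occs⇒Fresh : ∀ Γ {z} → z ∉ occs Γ → All (Fresh z) Γ
∉occs⇒Fresh Γ z∉ = ¬Any⇒All¬ Γ (z∉ ∘ ∈-concatMap⁺ (occ ∘ fm) ∘ Any.map (λ {A} → fv⊆occ (fm A)))

_≐_on_ : {A : Set} → (Var → A) → (Var → A) → List Var → Set
g ≐ h on vs = ∀ {v} → v ∈ vs → g v ≡ h v

update-agree : {A : Set} {g h : Var → A} (u : Var) (φ : Fm) (d : A) →
               g ≐ h on fv (∀' u φ) → (g [ u ↦ d ]) ≐ (h [ u ↦ d ]) on fv φ
update-agree {g = g} {h} u φ d g≐h {v} v∈ with v ≟ u
... | yes refl = trans (update-≡ g v d) (sym (update-≡ h v d))
... | no v≢u = begin
  (g [ u ↦ d ]) v  ≡⟨ update-≢ g d v≢u ⟩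
  g v              ≡⟨ g≐h (∈-filter⁺ (λ v → ¬? (v ≟ u)) v∈ v≢u) ⟩
  h v              ≡⟨ update-≢ h d v≢u ⟨
  (h [ u ↦ d ]) v  ∎
  where open ≡-Reasoning

binder-agree : {A : Set} {σ : Var → Var} {u w : Var} (φ : Fm) {g : Var → A} {d : A} →
               w ∉ map σ (fv (∀' u φ)) →
               ((g [ w ↦ d ]) ∘ (σ [ u ↦ w ])) ≐ ((g ∘ σ) [ u ↦ d ]) on fv φ
binder-agree {σ = σ} {u} {w} φ {g} {d} w∉ {v} v∈ with v ≟ u
... | yes refl = begin
  (g [ w ↦ d ]) ((σ [ v ↦ w ]) v)  ≡⟨ cong (g [ w ↦ d ]) (update-≡ σ v w) ⟩
  (g [ w ↦ d ]) w                  ≡⟨ update-≡ g w d ⟩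
  d                                ≡⟨ update-≡ (g ∘ σ) v d ⟨
  ((g ∘ σ) [ v ↦ d ]) v            ∎
  where open ≡-Reasoning
... | no v≢u = begin
  (g [ w ↦ d ]) ((σ [ u ↦ w ]) v)  ≡⟨ cong (g [ w ↦ d ]) (update-≢ σ w v≢u) ⟩
  (g [ w ↦ d ]) (σ v)              ≡⟨ update-≢ g d σv≢w ⟩
  g (σ v)                          ≡⟨ update-≢ (g ∘ σ) d v≢u ⟨
  ((g ∘ σ) [ u ↦ d ]) v            ∎
  where
  open ≡-Reasoning
  σv≢w : σ v ≢ w
  σv≢w σv≡w = w∉ (subst (_∈ _) σv≡w (∈-map⁺ σ (∈-filter⁺ (λ v → ¬? (v ≟ u)) v∈ v≢u)))

vmap-agree : {A : Set} {g h : Var → A} {n : ℕ} (xs : Vec Var n) →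
             g ≐ h on vtoList xs → vmap g xs ≡ vmap h xs
vmap-agree []       _   = refl
vmap-agree (x ∷ xs) g≐h = cong₂ _∷_ (g≐h (here refl)) (vmap-agree xs (g≐h ∘ there))

module Support (M : Model) where

  _⊆ₛ_ : State M → State M → Set
  t ⊆ₛ s = ∀ w → t w → s w

  Supp-atom : ∀ {s g h P} {xs ys : Vec Var (arity P)} →
              vmap g xs ≡ vmap h ys → Supp M s g (atom P xs) → Supp M s h (atom P ys)
  Supp-atom {s} {P = P} = subst (λ ds → ∀ w → s w → Lift (lsuc 0ℓ) (𝔍 M P w ds))

  Supp-coincide : ∀ φ {s g h} → g ≐ h on fv φ → Supp M s g φ → Supp M s h φ
  Supp-coincide (atom P xs) g≐h = Supp-atom (vmap-agree xs g≐h)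
  Supp-coincide ⊥'          g≐h S = S
  Supp-coincide (φ ⊃ ψ)     g≐h S t t⊆s =
    Supp-coincide ψ (g≐h ∘ ∈-++⁺ʳ (fv φ)) ∘ S t t⊆s ∘ Supp-coincide φ (sym ∘ g≐h ∘ ∈-++⁺ˡ)
  Supp-coincide (φ ∧ ψ)     g≐h =
    Data.Product.map (Supp-coincide φ (g≐h ∘ ∈-++⁺ˡ)) (Supp-coincide ψ (g≐h ∘ ∈-++⁺ʳ (fv φ)))
  Supp-coincide (φ ⩒ ψ)     g≐h =
    Sum.map (Supp-coincide φ (g≐h ∘ ∈-++⁺ˡ)) (Supp-coincide ψ (g≐h ∘ ∈-++⁺ʳ (fv φ)))
  Supp-coincide (∀' u φ)    g≐h S d = Supp-coincide φ (update-agree u φ d g≐h) (S d)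
  Supp-coincide (∃̄ u φ)     g≐h (d , S) = d , Supp-coincide φ (update-agree u φ d g≐h) S

  Supp-coincide-⇔ : ∀ φ {s g h} → g ≐ h on fv φ → Supp M s g φ ⇔ Supp M s h φ
  Supp-coincide-⇔ φ g≐h = mk⇔ (Supp-coincide φ g≐h) (Supp-coincide φ (sym ∘ g≐h))

  Supp-persistent : ∀ φ {s t g} → t ⊆ₛ s → Supp M s g φ → Supp M t g φ
  Supp-persistent (atom P xs) t⊆s S w = S w ∘ t⊆s w
  Supp-persistent ⊥'          t⊆s S w = S w ∘ t⊆s w
  Supp-persistent (φ ⊃ ψ)     t⊆s S r r⊆t = S r (λ w → t⊆s w ∘ r⊆t w)
  Supp-persistent (φ ∧ ψ)     t⊆s = Data.Product.map (Supp-persistent φ t⊆s) (Supp-persistent ψ t⊆s)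
  Supp-persistent (φ ⩒ ψ)     t⊆s = Sum.map (Supp-persistent φ t⊆s) (Supp-persistent ψ t⊆s)
  Supp-persistent (∀' u φ)    t⊆s S d = Supp-persistent φ t⊆s (S d)
  Supp-persistent (∃̄ u φ)     t⊆s = map₂ (Supp-persistent φ t⊆s)

  Supp-empty : ∀ φ {t g} → (∀ w → ¬ t w) → Supp M t g φ
  Supp-empty (atom P xs) t-empty w = ⊥-elim ∘ t-empty w
  Supp-empty ⊥'          t-empty w = ⊥-elim ∘ t-empty w
  Supp-empty (φ ⊃ ψ)     t-empty r r⊆t _ = Supp-empty ψ (λ w → t-empty w ∘ r⊆t w)
  Supp-empty (φ ∧ ψ)     t-empty = Supp-empty φ t-empty , Supp-empty ψ t-empty
  Supp-empty (φ ⩒ ψ)     t-empty = inj₁ (Supp-empty φ t-empty)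
  Supp-empty (∀' u φ)    t-empty d = Supp-empty φ t-empty
  Supp-empty (∃̄ u φ)     t-empty = d₀ M , Supp-empty φ t-empty

  Supp-sub : ∀ φ σ {s g} → Supp M s g (sub σ φ) ⇔ Supp M s (g ∘ σ) φ

  Supp-sub-binder : ∀ σ u φ {s g d} →
    Supp M s (g [ boundVar σ u φ ↦ d ]) (sub (σ [ u ↦ boundVar σ u φ ]) φ) ⇔
    Supp M s ((g ∘ σ) [ u ↦ d ]) φ
  Supp-sub-binder σ u φ {g = g} = ⇔.trans
    (Supp-sub φ (σ [ u ↦ boundVar σ u φ ]))
    (Supp-coincide-⇔ φ (binder-agree φ {g = g} (boundVar-∉ σ u φ)))

  Supp-sub (atom P xs) σ {g = g} = mk⇔ (Supp-atom (sym (map-∘ g σ xs))) (Supp-atom (map-∘ g σ xs))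
  Supp-sub ⊥'          σ = ⇔.refl
  Supp-sub (φ ⊃ ψ)     σ = mk⇔
    (λ S t t⊆s → to (Supp-sub ψ σ) ∘ S t t⊆s ∘ from (Supp-sub φ σ))
    (λ S t t⊆s → from (Supp-sub ψ σ) ∘ S t t⊆s ∘ to (Supp-sub φ σ))
  Supp-sub (φ ∧ ψ)     σ = Supp-sub φ σ ×-⇔ Supp-sub ψ σ
  Supp-sub (φ ⩒ ψ)     σ = Supp-sub φ σ ⊎-⇔ Supp-sub ψ σ
  Supp-sub (∀' u φ)    σ =
    mk⇔ (λ S d → to (Supp-sub-binder σ u φ) (S d)) (λ S d → from (Supp-sub-binder σ u φ) (S d))
  Supp-sub (∃̄ u φ)     σ =
    mk⇔ (map₂ (to (Supp-sub-binder σ u φ))) (map₂ (from (Supp-sub-binder σ u φ)))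

  Supp-[/] : ∀ φ x y {s g} → Supp M s g (φ [ y / x ]) ⇔ Supp M s (g [ x ↦ g y ]) φ
  Supp-[/] φ x y {g = g} = ⇔.trans
    (Supp-sub φ ((λ v → v) [ x ↦ y ]))
    (Supp-coincide-⇔ φ λ {v} _ → if-float g (does (v ≟ x)))

  Supp-[fresh/] : ∀ φ x z {s g d} → z ∉ fv (∀' x φ) →
                  Supp M s (g [ z ↦ d ]) (φ [ z / x ]) ⇔ Supp M s (g [ x ↦ d ]) φ
  Supp-[fresh/] φ x z {g = g} {d} z∉ = ⇔.trans (Supp-[/] φ x z) (Supp-coincide-⇔ φ agree)
    where
    open ≡-Reasoning
    g′ = g [ z ↦ d ]
    agree : (g′ [ x ↦ g′ z ]) ≐ (g [ x ↦ d ]) on fv φ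
    agree {v} v∈ with v ≟ x
    ... | yes refl = begin
      (g′ [ v ↦ g′ z ]) v  ≡⟨ update-≡ g′ v (g′ z) ⟩
      g′ z                 ≡⟨ update-≡ g z d ⟩
      d                    ≡⟨ update-≡ g v d ⟨
      (g [ v ↦ d ]) v      ∎
    ... | no v≢x = begin
      (g′ [ x ↦ g′ z ]) v  ≡⟨ update-≢ g′ (g′ z) v≢x ⟩
      g′ v                 ≡⟨ update-≢ g d (λ { refl → z∉ (∈-filter⁺ (λ v → ¬? (v ≟ x)) v∈ v≢x) }) ⟩
      g v                  ≡⟨ update-≢ g d v≢x ⟨
      (g [ x ↦ d ]) v      ∎

  Supp-update-fresh : ∀ φ {z s g d} → z ∉ fv φ → Supp M s (g [ z ↦ d ]) φ ⇔ Supp M s g φ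
  Supp-update-fresh φ {g = g} {d} z∉ = Supp-coincide-⇔ φ λ v∈ → update-≢ g d λ { refl → z∉ v∈ }

  module _ (f : ℕ → W M) where

    img-mono : ∀ {X Y} → Y ⊆L X → img M f Y ⊆ₛ img M f X
    img-mono Y⊆X w (k , k∈ , fk≡w) = k , Y⊆X k∈ , fk≡w

    img-∋ : ∀ {X k} → k ∈L X → img M f X (f k)
    img-∋ k∈ = _ , k∈ , refl

    atom-flat : ∀ {X g P xs} → (∀ k → k ∈L X → SatLF M f g (｛ k ｝ ∶ atom P xs)) →
                SatLF M f g (X ∶ atom P xs)
    atom-flat H w (k , k∈ , refl) = H k k∈ (f k) (img-∋ {｛ k ｝} (here refl))

    All-update-fresh : ∀ {Γ z g d} → All (Fresh z) Γ →
                       All (SatLF M f g) Γ → All (SatLF M f (g [ z ↦ d ])) Γ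
    All-update-fresh fresh hs =
      All.zipWith (λ {A} (z∉ , h) → from (Supp-update-fresh (fm A) z∉) h) (fresh , hs)

    Any-update-fresh : ∀ {Δ z g d} → All (Fresh z) Δ →
                       Any (SatLF M f (g [ z ↦ d ])) Δ → Any (SatLF M f g) Δ
    Any-update-fresh {A ∷ _} (z∉ ∷ _)     (here h)  = here (to (Supp-update-fresh (fm A) z∉) h)
    Any-update-fresh         (_   ∷ fresh) (there δ) = there (Any-update-fresh fresh δ)

Label-inhabited : (X : Label) → Σ ℕ (_∈L X)
Label-inhabited (label []      _ []≢[]) = contradiction refl []≢[]
Label-inhabited (label (k ∷ _) _ _)     = k , here refl

here-if-not-there : ∀ {a p} {A : Set a} {P : A → Set p} {x xs} → Any P (x ∷ xs) → ¬ Any P xs → P x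
here-if-not-there (here px) _  = px
here-if-not-there (there δ) ¬δ = contradiction δ ¬δ

module Classical (em : ExcludedMiddle (lsuc 0ℓ)) where

  here-unless-there : ∀ {A : Set} {P : A → Set (lsuc 0ℓ)} {x xs} → (¬ Any P xs → P x) → Any P (x ∷ xs)
  here-unless-there {P = P} {xs = xs} ¬δ⇒px with em {Any P xs}
  ... | yes δ = there δ
  ... | no ¬δ = here (¬δ⇒px ¬δ)

  module _ (M : Model) (f : ℕ → W M) where
    open Support M

    -- Y = {k ∈ X ∣ f k ∈ t}, found by excluded middle; it is a label unless empty.
    substate-image : ∀ X {t} → t ⊆ₛ img M f X →
                     (∀ w → ¬ t w) ⊎ Σ Label (λ Y → Y ⊆L X × t ⊆ₛ img M f Y × img M f Y ⊆ₛ t)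
    substate-image X {t} t⊆X =
      split (filter inT? (elems X)) (AllPairs.filter⁺ inT? (sorted X))
            (∈-filter⁻ inT?) (λ k∈ tfk → ∈-filter⁺ inT? k∈ (lift tfk))
      where
      inT? : Decidable (λ k → Lift (lsuc 0ℓ) (t (f k)))
      inT? _ = em
      split : ∀ ks → AllPairs _<_ ks →
              (∀ {k} → k ∈ ks → k ∈L X × Lift (lsuc 0ℓ) (t (f k))) →
              (∀ {k} → k ∈L X → t (f k) → k ∈ ks) →
              (∀ w → ¬ t w) ⊎ Σ Label (λ Y → Y ⊆L X × t ⊆ₛ img M f Y × img M f Y ⊆ₛ t)
      split [] _ _ complete = inj₁ empty
        where
        empty : ∀ w → ¬ t w
        empty w tw with t⊆X w tw
        ... | k , k∈ , refl with complete k∈ tw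
        ... | ()
      split (k ∷ ks) ks-sorted sound complete =
        inj₂ (label (k ∷ ks) ks-sorted (λ ()) , proj₁ ∘ sound , t⊆Y , Y⊆t)
        where
        t⊆Y : t ⊆ₛ img M f (label (k ∷ ks) ks-sorted (λ ()))
        t⊆Y w tw with t⊆X w tw
        ... | j , j∈ , refl = j , complete j∈ tw , refl
        Y⊆t : img M f (label (k ∷ ks) ks-sorted (λ ())) ⊆ₛ t
        Y⊆t w (j , j∈ , refl) = lower (proj₂ (sound j∈))

    ⊃-from-sublabels : ∀ {X g φ ψ} →
                       (∀ Y → Y ⊆L X → SatLF M f g (Y ∶ φ) → SatLF M f g (Y ∶ ψ)) →
                       SatLF M f g (X ∶ φ ⊃ ψ)
    ⊃-from-sublabels {X} {φ = φ} {ψ} H t t⊆X tφ with substate-image X t⊆X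
    ... | inj₁ t-empty = Supp-empty ψ t-empty
    ... | inj₂ (Y , Y⊆X , t⊆Y , Y⊆t) = Supp-persistent ψ t⊆Y (H Y Y⊆X (Supp-persistent φ Y⊆t tφ))

    sound : ∀ {Γ Δ} → G Γ Δ → ∀ g → SatSeq M f g Γ Δ
    sound (id {X} {Y} {P} {xs} Y⊆X) g (h ∷ _) =
      here (Supp-persistent (atom P xs) (img-mono f {X} {Y} Y⊆X) h)
    sound (⊥⇒ {X}) g (h ∷ _) with Label-inhabited X
    ... | k , k∈ = ⊥-elim (lower (h (f k) (img-∋ f {X} k∈)))
    sound (⇒at {X} ps) g hs = here-unless-there λ ¬δ →
      atom-flat f {X} λ k k∈ → here-if-not-there (sound (ps k k∈) g hs) ¬δ
    sound (⇒∧ p q) g hs with sound p g hs | sound q g hs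
    ... | here a  | here b  = here (a , b)
    ... | there δ | _       = there δ
    ... | _       | there δ = there δ
    sound (∧⇒ p) g ((a , b) ∷ hs) = sound p g (a ∷ b ∷ hs)
    sound (⇒⩒ p) g hs with sound p g hs
    ... | here a          = here (inj₁ a)
    ... | there (here b)  = here (inj₂ b)
    ... | there (there δ) = there δ
    sound (⩒⇒ p q) g (inj₁ a ∷ hs) = sound p g (a ∷ hs)
    sound (⩒⇒ p q) g (inj₂ b ∷ hs) = sound q g (b ∷ hs)
    sound (⇒⊃ {X} {φ} {ψ} ps) g hs = here-unless-there λ ¬δ →
      ⊃-from-sublabels {X} {g} {φ} {ψ} λ Y Y⊆X a → here-if-not-there (sound (ps Y Y⊆X) g (a ∷ hs)) ¬δ
    sound (⊃⇒ {X} Y Y⊆X p q) g (h ∷ hs) with sound p g (h ∷ hs)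
    ... | here a  = sound q g (h (img M f Y) (img-mono f {X} {Y} Y⊆X) a ∷ h ∷ hs)
    ... | there δ = δ
    sound (⇒∀ {X} {x} {φ} {Γ} {Δ} z z∉ p) g hs
      with ++⁻ Γ (∉occs⇒Fresh (Γ ++ (X ∶ ∀' x φ) ∷ Δ) z∉)
    ... | freshΓ , z∉φ ∷ freshΔ = here-unless-there λ ¬δ d →
      to (Supp-[fresh/] φ x z z∉φ)
         (here-if-not-there (sound p (g [ z ↦ d ]) (All-update-fresh f freshΓ hs))
                            (¬δ ∘ Any-update-fresh f freshΔ))
    sound (∀⇒ {x = x} {φ} y p) g (h ∷ hs) = sound p g (from (Supp-[/] φ x y) (h (g y)) ∷ h ∷ hs)
    sound (⇒∃̄ {x = x} {φ} y p) g hs with sound p g hs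
    ... | here a          = here a
    ... | there (here b)  = here (g y , to (Supp-[/] φ x y) b)
    ... | there (there δ) = there δ
    sound (∃̄⇒ {X} {x} {φ} {Γ} {Δ} z z∉ p) g ((d , a) ∷ hs)
      with ∉occs⇒Fresh ((X ∶ ∃̄ x φ) ∷ Γ ++ Δ) z∉
    ... | z∉φ ∷ freshΓΔ with ++⁻ Γ freshΓΔ
    ... | freshΓ , freshΔ = Any-update-fresh f freshΔ
      (sound p (g [ z ↦ d ]) (from (Supp-[fresh/] φ x z z∉φ) a ∷ All-update-fresh f freshΓ hs))
    sound (perm Γ↭Γ′ Δ↭Δ′ p) g hs = Any-resp-↭ Δ↭Δ′ (sound p g (All-resp-↭ (↭-sym Γ↭Γ′) hs))

proposition4 : ExcludedMiddle (lsuc 0ℓ) →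
    (Γ Δ : List LFm) → G Γ Δ →
    (M : Model) (g : Var → D M) (f : ℕ → W M) → SatSeq M f g Γ Δ
proposition4 em Γ Δ ⊢Γ⇒Δ M g f = Classical.sound em M f ⊢Γ⇒Δ g
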